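{- For every fixed integer $k\geq 3$ and every $n\in \mathbb{N}$, there exists a chordal graph $G_{k,n}$ on at least $n$ vertices and a super-orientation $D_{k,n}$ of $G_{k,n}$ such that $B(D_{k,n})$ is a disjoint union of paths, $\omega(G_{k,n}) = k$ and $\vec{\chi}(D_{k,n}) = \left\lfloor \frac{k+3}{2} \right\rfloor$.
   Context: A graph is chordal if it has no induced cycle of length at least 4. For a digraph $D$, the underlying graph $\mathrm{UG}(D)$ has vertex set $V(D)$ and $uv$ is an edge iff $uv$ or $vu$ is an arc; $D$ is a super-orientation of $G$ if $G=\mathrm{UG}(D)$. $B(D)$ is the undirected graph on $V(D)$ in which $uv$ is an edge iff both $uv$ and $vu$ are arcs of $D$. $\omega$ is the clique number. The dichromatic number $\vec{\chi}(D)$ is the least $k$ such that $V(D)$ can be partitioned into $k$ sets each inducing an acyclic subdigraph. -}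

module Defs where

open import Data.Nat using (ℕ; zero; suc; _≤_)
open import Data.Nat.DivMod using (_%_; m%n<n)
open import Data.Fin using (Fin; toℕ; fromℕ<)
open import Data.Bool using (Bool; true; false; _∨_; _∧_)
open import Data.Product using (Σ; ∃; _×_; _,_)
open import Data.Sum using (_⊎_)
open import Relation.Nullary using (¬_)
open import Relation.Binary.PropositionalEquality using (_≡_; _≢_)
open import Function.Bundles using (_⇔_)

next : ∀ {l} → Fin (suc l) → Fin (suc l)
next {l} i = fromℕ< (m%n<n (suc (toℕ i)) (suc l))

record Graph (m : ℕ) : Set where
  field
    adj   : Fin m → Fin m → Bool
    sym   : ∀ u v → adj u v ≡ adj v u
    irrefl : ∀ u → adj u u ≡ false
open Graph public

record Digraph (m : ℕ) : Set where
  field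
    arc      : Fin m → Fin m → Bool
    loopless : ∀ u → arc u u ≡ false
open Digraph public

Injective : ∀ {a m} → (Fin a → Fin m) → Set
Injective f = ∀ i j → f i ≡ f j → i ≡ j

SuperOrientation : ∀ {m} → Digraph m → Graph m → Set
SuperOrientation D G = ∀ u v → adj G u v ≡ (arc D u v ∨ arc D v u)

BAdj : ∀ {m} → Digraph m → Fin m → Fin m → Bool
BAdj D u v = arc D u v ∧ arc D v u

-- An (undirected) relation on Fin m is a disjoint union of paths:
-- vertices are labelled by (component, position) injectively, positions in
-- each component form an initial segment {0,…,len-1}, and u,v adjacent iff
-- same component and consecutive positions.  (Single vertices are paths.)
DisjointUnionOfPaths : ∀ {m} → (Fin m → Fin m → Bool) → Set
DisjointUnionOfPaths {m} E =
  Σ (Fin m → ℕ) λ comp → Σ (Fin m → ℕ) λ pos →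
    (∀ u v → comp u ≡ comp v → pos u ≡ pos v → u ≡ v)
    × (∀ v p → pos v ≡ suc p → ∃ λ u → comp u ≡ comp v × pos u ≡ p)
    × (∀ u v → (E u v ≡ true) ⇔
         (comp u ≡ comp v × (pos v ≡ suc (pos u) ⊎ pos u ≡ suc (pos v))))

InducedCycle : ∀ {m} → Graph m → (l : ℕ) → Set
InducedCycle {m} G l =
  Σ (Fin (suc l) → Fin m) λ c → Injective c
    × (∀ i j → (adj G (c i) (c j) ≡ true) ⇔ (j ≡ next i ⊎ i ≡ next j))

-- Chordal: no induced cycle of length at least 4
Chordal : ∀ {m} → Graph m → Set
Chordal G = ∀ l → 3 ≤ l → ¬ InducedCycle G l

HasClique : ∀ {m} → Graph m → ℕ → Set
HasClique {m} G j =
  Σ (Fin j → Fin m) λ f → Injective f × (∀ a b → a ≢ b → adj G (f a) (f b) ≡ true)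

CliqueNumber : ∀ {m} → Graph m → ℕ → Set
CliqueNumber G k = HasClique G k × (∀ j → HasClique G j → j ≤ k)

DirectedCycleIn : ∀ {m} → Digraph m → (Fin m → Set) → Set
DirectedCycleIn {m} D S =
  Σ ℕ λ l → 1 ≤ l × Σ (Fin (suc l) → Fin m) λ c → Injective c
    × (∀ i → arc D (c i) (c (next i)) ≡ true) × (∀ i → S (c i))

Dicolourable : ∀ {m} → Digraph m → ℕ → Set
Dicolourable {m} D j =
  Σ (Fin m → Fin j) λ col → ∀ (a : Fin j) → ¬ DirectedCycleIn D (λ v → col v ≡ a)

DichromaticNumber : ∀ {m} → Digraph m → ℕ → Set
DichromaticNumber D c = Dicolourable D c × (∀ j → Dicolourable D j → c ≤ j)

-- From a digraph D with clique number k and dichromatic number c whose underlying graph is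
-- chordal, build a transitive tournament T on c + 1 vertices and, for every pair (a , b) of
-- vertices of T, a copy of D all of whose vertices dominate a and are dominated by b.
-- Ordering T before the copies is a perfect elimination ordering, the largest cliques are
-- {a , b} plus a clique of a copy, and the digons are those of the copies. Colouring T with
-- a new colour gives c + 1 colours; with only c colours two vertices a < b of T share a
-- colour γ, and the triangles a → b → u → a forbid γ on the copy (a , b), which then needs
-- c colours among the c − 1 others. So (k , c) becomes (k + 2 , c + 1); starting from a
-- digon (2 , 2) and a five-vertex fan (3 , 3), and adding isolated vertices to reach n
-- vertices, gives every k ≥ 3 with c = ⌊(k + 3) / 2⌋.

module Submission where

open import Defs hiding (sym; arc; loopless)

open import Data.Bool using (Bool; true; false; _∨_; _∧_; not)
open import Data.Bool.Properties using (∨-comm; ∨-zeroʳ; ∧-comm; ∧-zeroʳ; ∧-conicalˡ; ∧-conicalʳ; ¬-not)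
import Data.Bool.Properties as Bool
open import Data.Empty using (⊥; ⊥-elim)
open import Data.Fin as Fin using (Fin; toℕ; _≟_; punchIn; punchOut; inject₁; inject≤)
open import Data.Fin.Patterns using (0F; 1F; 2F; 3F; 4F)
open import Data.Fin.Properties
  using (toℕ-fromℕ<; toℕ-injective; toℕ<n; suc-injective; inject₁-injective; inject≤-injective;
         punchInᵢ≢i; punchIn-injective; punchIn-punchOut; injective⇒≤; pigeonhole; all?; any?; +↔⊎; *↔×)
open import Data.Nat using (ℕ; zero; suc; pred; _+_; _*_; _≤_; _<_; z≤n; s≤s; NonZero)
open import Data.Nat.DivMod
  using (_%_; _/_; m<n⇒m%n≡m; %-distribˡ-+; m%n%n≡m%n; [m+n]%n≡m%n; m≡m%n+[m/n]*n; m/n≡1+[m∸n]/n)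
open import Data.Nat.Properties
  using (_<?_; _≤?_; <-cmp; <-asym; <-irrefl; <⇒≢; <⇒≤; ≰⇒>; ≤∧≢⇒<; ≤-refl; ≤-trans; ≤-total;
         +-suc; +-comm; +-identityʳ; +-cancelˡ-≡; +-cancelˡ-<; m≤m+n; m≤n⇒∃[o]m+o≡n)
import Data.Nat.Properties as ℕ
open import Data.Product using (Σ; ∃; _×_; _,_; proj₁; proj₂)
open import Data.Product.Function.NonDependent.Propositional using (_×-↔_)
open import Data.Product.Properties using (≡-dec)
open import Data.Sum using (_⊎_; inj₁; inj₂; [_,_])
open import Data.Sum.Function.Propositional using (_⊎-↔_)
open import Data.Sum.Properties using (inj₁-injective; inj₂-injective)
open import Function.Base using (_∘_; _on_)
open import Function.Bundles using (_⇔_; mk⇔; Equivalence; _↔_; Inverse)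
open import Function.Properties.Inverse using (↔-refl; ↔-sym; ↔-trans)
open import Relation.Binary.Definitions using (DecidableEquality; tri<; tri≈; tri>)
open import Relation.Binary.PropositionalEquality
  using (_≡_; _≢_; refl; sym; trans; cong; cong₂; subst; subst₂; module ≡-Reasoning)
open import Relation.Nullary using (¬_; Dec; yes; no; does; contradiction)
open import Relation.Nullary.Decidable using (dec-true; dec-false; from-yes; ¬?; _×-dec_; _⊎-dec_; _→-dec_)

open ≡-Reasoning

next^ : ∀ {l} → ℕ → Fin (suc l) → Fin (suc l)
next^ zero    i = i
next^ (suc n) i = next (next^ n i)

[1+m%d]%d≡[1+m]%d : ∀ m d .{{_ : NonZero d}} → suc (m % d) % d ≡ suc m % d
[1+m%d]%d≡[1+m]%d m d = begin
  (1 + m % d) % d          ≡⟨ %-distribˡ-+ 1 (m % d) d ⟩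
  (1 % d + m % d % d) % d  ≡⟨ cong (λ x → (1 % d + x) % d) (m%n%n≡m%n m d) ⟩
  (1 % d + m % d) % d      ≡⟨ %-distribˡ-+ 1 m d ⟨
  (1 + m) % d              ∎

toℕ-next^ : ∀ {l} n (i : Fin (suc l)) → toℕ (next^ n i) ≡ (toℕ i + n) % suc l
toℕ-next^ {l} zero i = begin
  toℕ i               ≡⟨ m<n⇒m%n≡m (toℕ<n i) ⟨
  toℕ i % suc l       ≡⟨ cong (_% suc l) (+-identityʳ (toℕ i)) ⟨
  (toℕ i + 0) % suc l ∎
toℕ-next^ {l} (suc n) i = begin
  toℕ (next (next^ n i))               ≡⟨ toℕ-fromℕ< _ ⟩
  suc (toℕ (next^ n i)) % suc l        ≡⟨ cong (λ x → suc x % suc l) (toℕ-next^ n i) ⟩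
  suc ((toℕ i + n) % suc l) % suc l    ≡⟨ [1+m%d]%d≡[1+m]%d (toℕ i + n) (suc l) ⟩
  suc (toℕ i + n) % suc l              ≡⟨ cong (_% suc l) (+-suc (toℕ i) n) ⟨
  (toℕ i + suc n) % suc l              ∎

next^-period : ∀ {l} (i : Fin (suc l)) → next^ (suc l) i ≡ i
next^-period {l} i = toℕ-injective (begin
  toℕ (next^ (suc l) i)    ≡⟨ toℕ-next^ (suc l) i ⟩
  (toℕ i + suc l) % suc l  ≡⟨ [m+n]%n≡m%n (toℕ i) (suc l) ⟩
  toℕ i % suc l            ≡⟨ m<n⇒m%n≡m (toℕ<n i) ⟩
  toℕ i                    ∎)

next-surjective : ∀ {l} (i : Fin (suc l)) → ∃ λ j → next j ≡ i
next-surjective {l} i = next^ l i , next^-period i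

-- (x + n) mod (l + 1) = x forces n to be a multiple of l + 1.
next^≢id : ∀ {l} n → 0 < n → n ≤ l → (i : Fin (suc l)) → next^ n i ≢ i
next^≢id {l} n 0<n n≤l i eq = not-multiple ((toℕ i + n) / suc l) n≡q*d
  where
  remainder≡i : (toℕ i + n) % suc l ≡ toℕ i
  remainder≡i = trans (sym (toℕ-next^ n i)) (cong toℕ eq)
  n≡q*d : n ≡ ((toℕ i + n) / suc l) * suc l
  n≡q*d = +-cancelˡ-≡ (toℕ i) _ _ (begin
    toℕ i + n                                          ≡⟨ m≡m%n+[m/n]*n (toℕ i + n) (suc l) ⟩
    (toℕ i + n) % suc l + (toℕ i + n) / suc l * suc l  ≡⟨ cong (_+ (toℕ i + n) / suc l * suc l) remainder≡i ⟩
    toℕ i + (toℕ i + n) / suc l * suc l                ∎)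
  not-multiple : ∀ q → n ≢ q * suc l
  not-multiple zero    e = <-irrefl (sym e) 0<n
  not-multiple (suc q) e = <-irrefl refl (≤-trans (subst (suc l ≤_) (sym e) (m≤m+n (suc l) _)) n≤l)

next-invariant⇒constant : ∀ {l} {B : Set} (f : Fin (suc l) → B) →
  (∀ i → f (next i) ≡ f i) → ∀ i → f i ≡ f 0F
next-invariant⇒constant {l} f invariant i = begin
  f i                   ≡⟨ cong f (toℕ-injective i≡next^ᵢ0) ⟩
  f (next^ (toℕ i) 0F)  ≡⟨ along (toℕ i) 0F ⟩
  f 0F                  ∎
  where
  i≡next^ᵢ0 : toℕ i ≡ toℕ (next^ (toℕ i) 0F)
  i≡next^ᵢ0 = sym (trans (toℕ-next^ (toℕ i) 0F) (m<n⇒m%n≡m (toℕ<n i)))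
  along : ∀ t j → f (next^ t j) ≡ f j
  along zero    j = refl
  along (suc t) j = trans (invariant (next^ t j)) (along t j)

Adjacent : {V : Set} → (V → V → Bool) → V → V → Bool
Adjacent A u v = A u v ∨ A v u

Digon : {V : Set} → (V → V → Bool) → V → V → Bool
Digon A u v = A u v ∧ A v u

arc⇒adjacent : ∀ {V : Set} (A : V → V → Bool) {u v} → A u v ≡ true → Adjacent A u v ≡ true
arc⇒adjacent A {u} {v} uv = cong (_∨ A v u) uv

adjacent-sym : ∀ {V : Set} (A : V → V → Bool) {u v} → Adjacent A u v ≡ Adjacent A v u
adjacent-sym A {u} {v} = ∨-comm (A u v) (A v u)

adjacent⇒≢ : ∀ {V : Set} {A : V → V → Bool} → (∀ v → A v v ≡ false) →
  ∀ {u v} → Adjacent A u v ≡ true → u ≢ v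
adjacent⇒≢ loopless {u} e refl = contradiction (trans (sym e) (cong₂ _∨_ (loopless u) (loopless u))) λ ()

∨-true : ∀ x {y} → x ∨ y ≡ true → x ≡ true ⊎ y ≡ true
∨-true true  _ = inj₁ refl
∨-true false e = inj₂ e

-- Over V = Fin m these notions unfold to DirectedCycleIn, InducedCycle, HasClique,
-- Dicolourable and DisjointUnionOfPaths; path components may carry labels from any set L.
DirectedCycle : {V : Set} → (V → V → Bool) → (V → Set) → Set
DirectedCycle {V} A S =
  Σ ℕ λ l → 1 ≤ l × Σ (Fin (suc l) → V) λ c → (∀ i j → c i ≡ c j → i ≡ j)
    × (∀ i → A (c i) (c (next i)) ≡ true) × (∀ i → S (c i))

InducedCycleOf : {V : Set} → (V → V → Bool) → ℕ → Set
InducedCycleOf {V} E l =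
  Σ (Fin (suc l) → V) λ c → (∀ i j → c i ≡ c j → i ≡ j)
    × (∀ i j → (E (c i) (c j) ≡ true) ⇔ (j ≡ next i ⊎ i ≡ next j))

CliqueOf : {V : Set} → (V → V → Bool) → ℕ → Set
CliqueOf {V} E j =
  Σ (Fin j → V) λ f → (∀ a b → f a ≡ f b → a ≡ b) × (∀ a b → a ≢ b → E (f a) (f b) ≡ true)

ProperColouring : {V : Set} → (V → V → Bool) → ℕ → Set
ProperColouring {V} E k = Σ (V → Fin k) λ col → ∀ u v → E u v ≡ true → col u ≢ col v

AcyclicColouring : {V : Set} → (V → V → Bool) → ℕ → Set
AcyclicColouring {V} A j = Σ (V → Fin j) λ col → ∀ a → ¬ DirectedCycle A (λ v → col v ≡ a)

PathDecomposition : {V : Set} → Set → (V → V → Bool) → Set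
PathDecomposition {V} L E =
  Σ (V → L) λ comp → Σ (V → ℕ) λ pos →
    (∀ u v → comp u ≡ comp v → pos u ≡ pos v → u ≡ v)
    × (∀ v p → pos v ≡ suc p → ∃ λ u → comp u ≡ comp v × pos u ≡ p)
    × (∀ u v → (E u v ≡ true) ⇔ (comp u ≡ comp v × (pos v ≡ suc (pos u) ⊎ pos u ≡ suc (pos v))))

record EliminationOrdering {V : Set} (E : V → V → Bool) : Set where
  field
    rank                      : V → ℕ
    rank-separates            : ∀ u v → E u v ≡ true → rank u ≢ rank v
    lower-neighbours-adjacent : ∀ v w₁ w₂ → rank w₁ < rank v → rank w₂ < rank v →
                                E v w₁ ≡ true → E v w₂ ≡ true → w₁ ≢ w₂ → E w₁ w₂ ≡ true

argmax : ∀ {n} (h : Fin (suc n) → ℕ) → ∃ λ i → ∀ j → h j ≤ h i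
argmax {zero}  h = 0F , λ { 0F → ≤-refl }
argmax {suc n} h with argmax (λ j → h (Fin.suc j))
... | i , max with ≤-total (h 0F) (h (Fin.suc i))
...   | inj₁ ≤i = Fin.suc i , λ { 0F → ≤i ; (Fin.suc j) → max j }
...   | inj₂ ≥i = 0F  , λ { 0F → ≤-refl ; (Fin.suc j) → ≤-trans (max j) ≥i }

potential⇒no-cycle : ∀ {V : Set} (A : V → V → Bool) (S : V → Set) (h : V → ℕ) →
  (∀ u v → S u → S v → A u v ≡ true → h u < h v) → ¬ DirectedCycle A S
potential⇒no-cycle A S h increasing (l , _ , c , _ , arcs , inS) with argmax (λ i → h (c i))
... | i , max = <-irrefl refl (≤-trans (increasing _ _ (inS i) (inS (next i)) (arcs i)) (max (next i)))

proper⇒acyclic : ∀ {V : Set} (A : V → V → Bool) {k} →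
  ProperColouring (Adjacent A) k → AcyclicColouring A k
proper⇒acyclic A (col , proper) = col , λ a (_ , _ , c , _ , arcs , inS) →
  proper (c 0F) (c (next 0F)) (arc⇒adjacent A (arcs 0F))
    (trans (inS 0F) (sym (inS (next 0F))))

map-cycle : ∀ {V W : Set} {A : V → V → Bool} {B : W → W → Bool} {S : V → Set} {T : W → Set}
  (g : V → W) → (∀ u v → g u ≡ g v → u ≡ v) → (∀ u v → A u v ≡ true → B (g u) (g v) ≡ true) →
  (∀ u → S u → T (g u)) → DirectedCycle A S → DirectedCycle B T
map-cycle g g-injective g-arc g-S (l , 1≤l , c , c-injective , arcs , inS) =
  l , 1≤l , (λ i → g (c i)) , (λ i j e → c-injective i j (g-injective _ _ e)) ,
  (λ i → g-arc _ _ (arcs i)) , (λ i → g-S _ (inS i))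

digon-cycle : ∀ {V : Set} {A : V → V → Bool} {S : V → Set} {u v} →
  A u v ≡ true → A v u ≡ true → u ≢ v → S u → S v → DirectedCycle A S
digon-cycle {u = u} {v} uv vu u≢v Su Sv = 1 , ≤-refl , c , injective , arcs , inS
  where
  c : Fin 2 → _
  c 0F = u
  c 1F = v
  injective : ∀ i j → c i ≡ c j → i ≡ j
  injective 0F 0F _ = refl
  injective 0F 1F e = ⊥-elim (u≢v e)
  injective 1F 0F e = ⊥-elim (u≢v (sym e))
  injective 1F 1F _ = refl
  arcs : ∀ i → _
  arcs 0F = uv
  arcs 1F = vu
  inS : ∀ i → _
  inS 0F = Su
  inS 1F = Sv

triangle-cycle : ∀ {V : Set} {A : V → V → Bool} {S : V → Set} {u v w} →
  A u v ≡ true → A v w ≡ true → A w u ≡ true → u ≢ v → v ≢ w → w ≢ u →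
  S u → S v → S w → DirectedCycle A S
triangle-cycle {u = u} {v} {w} uv vw wu u≢v v≢w w≢u Su Sv Sw = 2 , s≤s z≤n , c , injective , arcs , inS
  where
  c : Fin 3 → _
  c 0F = u
  c 1F = v
  c 2F = w
  injective : ∀ i j → c i ≡ c j → i ≡ j
  injective 0F 0F _ = refl
  injective 0F 1F e = ⊥-elim (u≢v e)
  injective 0F 2F e = ⊥-elim (w≢u (sym e))
  injective 1F 0F e = ⊥-elim (u≢v (sym e))
  injective 1F 1F _ = refl
  injective 1F 2F e = ⊥-elim (v≢w e)
  injective 2F 0F e = ⊥-elim (w≢u e)
  injective 2F 1F e = ⊥-elim (v≢w (sym e))
  injective 2F 2F _ = refl
  arcs : ∀ i → _
  arcs 0F = uv
  arcs 1F = vw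
  arcs 2F = wu
  inS : ∀ i → _
  inS 0F = Su
  inS 1F = Sv
  inS 2F = Sw

does⇒ : ∀ {P : Set} (P? : Dec P) → does P? ≡ true → P
does⇒ (yes p) _ = p

cycle-pullback : ∀ {V W : Set} {A : V → V → Bool} {B : W → W → Bool} {S : V → Set} {T : W → Set}
  (g : V → W) → (∀ u v → g u ≡ g v → u ≡ v) → (∀ u v → B (g u) (g v) ≡ true → A u v ≡ true) →
  (∀ u → T (g u) → S u) → (∀ w w′ → T w → B w w′ ≡ true → ∃ λ u → g u ≡ w) →
  DirectedCycle B T → DirectedCycle A S
cycle-pullback {B = B} {T = T} g g-injective g-arc g-S in-image (l , 1≤l , c , c-injective , arcs , inT) =
  l , 1≤l , d , d-injective , d-arcs , λ i → g-S _ (subst T (sym (g∘d i)) (inT i))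
  where
  preimage : ∀ i → ∃ λ u → g u ≡ c i
  preimage i = in-image _ _ (inT i) (arcs i)
  d : Fin (suc l) → _
  d i = proj₁ (preimage i)
  g∘d : ∀ i → g (d i) ≡ c i
  g∘d i = proj₂ (preimage i)
  d-injective : ∀ i j → d i ≡ d j → i ≡ j
  d-injective i j e = c-injective i j (trans (sym (g∘d i)) (trans (cong g e) (g∘d j)))
  d-arcs : ∀ i → _
  d-arcs i = g-arc _ _ (subst₂ (λ x y → B x y ≡ true) (sym (g∘d i)) (sym (g∘d (next i))) (arcs i))

digon-colours-differ : ∀ {V : Set} {A : V → V → Bool} {j} (χ : AcyclicColouring A j) {u v} →
  A u v ≡ true → A v u ≡ true → u ≢ v → proj₁ χ u ≢ proj₁ χ v
digon-colours-differ {A = A} (col , acyclic) {u} uv vu u≢v same =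
  acyclic (col u) (digon-cycle {A = A} {S = λ w → col w ≡ col u} uv vu u≢v refl (sym same))

-- The highest-ranked vertex of an induced cycle has two lower-ranked neighbours
-- on it; these must be adjacent, which is a chord once the cycle has length ≥ 4.
eliminationOrdering⇒no-long-induced-cycle : ∀ {V : Set} {E : V → V → Bool} →
  EliminationOrdering E → ∀ l → 3 ≤ l → ¬ InducedCycleOf E l
eliminationOrdering⇒no-long-induced-cycle {E = E} ord l 3≤l (c , c-injective , edge⇔)
  with argmax (λ i → EliminationOrdering.rank ord (c i))
... | i , max with next-surjective i
...   | p , next-p≡i = no-chord (Equivalence.to (edge⇔ (next i) p) chord)
  where
  open EliminationOrdering ord
  i→next : E (c i) (c (next i)) ≡ true
  i→next = Equivalence.from (edge⇔ i (next i)) (inj₁ refl)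
  i→p : E (c i) (c p) ≡ true
  i→p = Equivalence.from (edge⇔ i p) (inj₂ (sym next-p≡i))
  lower : ∀ {j} → E (c i) (c j) ≡ true → rank (c j) < rank (c i)
  lower e = ≤∧≢⇒< (max _) (λ r → rank-separates _ _ e (sym r))
  next≢p : c (next i) ≢ c p
  next≢p e = next^≢id 2 (s≤s z≤n) (≤-trans (s≤s (s≤s z≤n)) 3≤l) i
    (trans (cong next (c-injective _ _ e)) next-p≡i)
  chord : E (c (next i)) (c p) ≡ true
  chord = lower-neighbours-adjacent (c i) _ _ (lower i→next) (lower i→p) i→next i→p next≢p
  no-chord : p ≡ next (next i) ⊎ next i ≡ next p → ⊥
  no-chord (inj₁ e) = next^≢id 3 (s≤s z≤n) 3≤l i (trans (cong next (sym e)) next-p≡i)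
  no-chord (inj₂ e) = next^≢id 1 (s≤s z≤n) (≤-trans (s≤s z≤n) 3≤l) i (trans e next-p≡i)

colouring-bounds-clique : ∀ {V : Set} {E : V → V → Bool} {k j} →
  ProperColouring E k → CliqueOf E j → j ≤ k
colouring-bounds-clique (col , proper) (f , _ , adjacent) = injective⇒≤ col∘f-injective
  where
  col∘f-injective : ∀ {a b} → col (f a) ≡ col (f b) → a ≡ b
  col∘f-injective {a} {b} e with a Fin.≟ b
  ... | yes a≡b = a≡b
  ... | no  a≢b = ⊥-elim (proper _ _ (adjacent a b a≢b) e)

module _ {V W : Set} where

  eliminationOrdering-on : ∀ {E : V → V → Bool} (g : W → V) → (∀ u v → g u ≡ g v → u ≡ v) →
    EliminationOrdering E → EliminationOrdering (E on g)
  eliminationOrdering-on g g-injective ord = record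
    { rank                      = rank ∘ g
    ; rank-separates            = λ u v → rank-separates (g u) (g v)
    ; lower-neighbours-adjacent = λ v w₁ w₂ r₁ r₂ e₁ e₂ w₁≢w₂ →
        lower-neighbours-adjacent (g v) (g w₁) (g w₂) r₁ r₂ e₁ e₂ (w₁≢w₂ ∘ g-injective _ _)
    }
    where open EliminationOrdering ord

  properColouring-map : ∀ {E : V → V → Bool} {F : W → W → Bool} {k} (g : W → V) →
    (∀ u v → F u v ≡ true → E (g u) (g v) ≡ true) → ProperColouring E k → ProperColouring F k
  properColouring-map g g-edge (col , proper) = col ∘ g , λ u v e → proper _ _ (g-edge u v e)

  clique-map : ∀ {E : V → V → Bool} {F : W → W → Bool} {j} (g : V → W) →
    (∀ u v → g u ≡ g v → u ≡ v) →
    (∀ u v → E u v ≡ true → F (g u) (g v) ≡ true) → CliqueOf E j → CliqueOf F j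
  clique-map g g-injective g-edge (f , f-injective , adjacent) =
    g ∘ f , (λ a b e → f-injective a b (g-injective _ _ e)) , λ a b a≢b → g-edge _ _ (adjacent a b a≢b)

  acyclicColouring-map : ∀ {A : V → V → Bool} {B : W → W → Bool} {j} (g : W → V) →
    (∀ u v → g u ≡ g v → u ≡ v) →
    (∀ u v → B u v ≡ true → A (g u) (g v) ≡ true) → AcyclicColouring A j → AcyclicColouring B j
  acyclicColouring-map {A = A} g g-injective g-arc (col , acyclic) =
    col ∘ g , λ a → acyclic a ∘ map-cycle {B = A} {T = λ v → col v ≡ a} g g-injective g-arc (λ _ Su → Su)

  pathDecomposition-on : ∀ {L : Set} {E : V → V → Bool} (g : W → V) (h : V → W) → (∀ v → g (h v) ≡ v) →
    (∀ u v → g u ≡ g v → u ≡ v) → PathDecomposition L E → PathDecomposition L (E on g)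
  pathDecomposition-on g h g∘h≗id g-injective (comp , pos , unique , predecessor , edge⇔) =
    comp ∘ g , pos ∘ g ,
    (λ u v c p → g-injective u v (unique (g u) (g v) c p)) ,
    (λ v p e → let (u , c , q) = predecessor (g v) p e in
                 h u , trans (cong comp (g∘h≗id u)) c , trans (cong pos (g∘h≗id u)) q) ,
    (λ u v → edge⇔ (g u) (g v))

pathDecomposition-relabel : ∀ {V L L′ : Set} {E : V → V → Bool} (ℓ : L → L′) →
  (∀ a b → ℓ a ≡ ℓ b → a ≡ b) → PathDecomposition L E → PathDecomposition L′ E
pathDecomposition-relabel ℓ ℓ-injective (comp , pos , unique , predecessor , edge⇔) =
  ℓ ∘ comp , pos ,
  (λ u v c → unique u v (ℓ-injective _ _ c)) ,
  (λ v p e → let (u , c , q) = predecessor v p e in u , cong ℓ c , q) ,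
  (λ u v → mk⇔ (λ e → let (c , q) = Equivalence.to (edge⇔ u v) e in cong ℓ c , q)
               (λ (c , q) → Equivalence.from (edge⇔ u v) (ℓ-injective _ _ c , q)))

pathDecomposition-⊎ : ∀ {I V L : Set} {E : I ⊎ V → I ⊎ V → Bool} →
  (∀ i w → E (inj₁ i) w ≡ false) → (∀ w i → E w (inj₁ i) ≡ false) →
  PathDecomposition L (E on inj₂) → PathDecomposition (I ⊎ L) E
pathDecomposition-⊎ {I} {V} {L} {E} no-edgeˡ no-edgeʳ (comp , pos , unique , predecessor , edge⇔) =
  comp′ , pos′ , unique′ , predecessor′ , λ u v → mk⇔ (to u v) (from u v)
  where
  comp′ : I ⊎ V → I ⊎ L
  comp′ (inj₁ i) = inj₁ i
  comp′ (inj₂ u) = inj₂ (comp u)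
  pos′ : I ⊎ V → ℕ
  pos′ (inj₁ _) = 0
  pos′ (inj₂ u) = pos u
  unique′ : ∀ u v → comp′ u ≡ comp′ v → pos′ u ≡ pos′ v → u ≡ v
  unique′ (inj₁ i) (inj₁ j) c _ = cong inj₁ (inj₁-injective c)
  unique′ (inj₂ u) (inj₂ v) c p = cong inj₂ (unique u v (inj₂-injective c) p)
  predecessor′ : ∀ v p → pos′ v ≡ suc p → ∃ λ u → comp′ u ≡ comp′ v × pos′ u ≡ p
  predecessor′ (inj₂ v) p e = let (u , c , q) = predecessor v p e in inj₂ u , cong inj₂ c , q
  no-edge : ∀ {u v} → E u v ≡ false → ¬ E u v ≡ true
  no-edge f t = contradiction (trans (sym t) f) λ ()
  to : ∀ u v → E u v ≡ true → comp′ u ≡ comp′ v × (pos′ v ≡ suc (pos′ u) ⊎ pos′ u ≡ suc (pos′ v))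
  to (inj₁ i) v        = ⊥-elim ∘ no-edge (no-edgeˡ i v)
  to (inj₂ u) (inj₁ i) = ⊥-elim ∘ no-edge (no-edgeʳ (inj₂ u) i)
  to (inj₂ u) (inj₂ v) e = let (c , p) = Equivalence.to (edge⇔ u v) e in cong inj₂ c , p
  from : ∀ u v → comp′ u ≡ comp′ v × (pos′ v ≡ suc (pos′ u) ⊎ pos′ u ≡ suc (pos′ v)) → E u v ≡ true
  from (inj₁ _) (inj₁ _) (_ , inj₁ ())
  from (inj₁ _) (inj₁ _) (_ , inj₂ ())
  from (inj₂ u) (inj₂ v) (c , p) = Equivalence.from (edge⇔ u v) (inj₂-injective c , p)

Copies : ∀ {P V : Set} → DecidableEquality P → (V → V → Bool) → P × V → P × V → Bool
Copies _≟_ A (p , u) (q , v) = does (p ≟ q) ∧ A u v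

module CopiesProperties {P V : Set} (_≟_ : DecidableEquality P) {A : V → V → Bool} where

  copies-same : ∀ p u v → Copies _≟_ A (p , u) (p , v) ≡ A u v
  copies-same p u v = cong (_∧ A u v) (dec-true (p ≟ p) refl)

  copies-arc : ∀ {p q u v} → Copies _≟_ A (p , u) (q , v) ≡ true → p ≡ q × A u v ≡ true
  copies-arc {p} {q} e = does⇒ (p ≟ q) (∧-conicalˡ _ _ e) , ∧-conicalʳ _ _ e

  copies-adjacent : ∀ {p q u v} → Adjacent (Copies _≟_ A) (p , u) (q , v) ≡ true →
    p ≡ q × Adjacent A u v ≡ true
  copies-adjacent {p} {q} {u} {v} e with ∨-true (Copies _≟_ A (p , u) (q , v)) e
  ... | inj₁ uv = let (p≡q , a) = copies-arc uv in p≡q , arc⇒adjacent A a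
  ... | inj₂ vu = let (q≡p , a) = copies-arc vu in sym q≡p , trans (adjacent-sym A) (arc⇒adjacent A a)

  copies-adjacent-same : ∀ p u v → Adjacent (Copies _≟_ A) (p , u) (p , v) ≡ Adjacent A u v
  copies-adjacent-same p u v = cong₂ _∨_ (copies-same p u v) (copies-same p v u)

  -- A cycle stays in one copy, since arcs never leave a copy.
  copies-cycle : ∀ {S : V → Set} → DirectedCycle (Copies _≟_ A) (S ∘ proj₂) → DirectedCycle A S
  copies-cycle (l , 1≤l , c , c-injective , arcs , inS) =
    l , 1≤l , proj₂ ∘ c , injective , (λ i → proj₂ (copies-arc (arcs i))) , inS
    where
    same-copy : ∀ i → proj₁ (c i) ≡ proj₁ (c 0F)
    same-copy = next-invariant⇒constant (proj₁ ∘ c) (λ i → sym (proj₁ (copies-arc (arcs i))))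
    injective : ∀ i j → proj₂ (c i) ≡ proj₂ (c j) → i ≡ j
    injective i j e = c-injective i j (cong₂ _,_ (trans (same-copy i) (sym (same-copy j))) e)

  copies-digon : ∀ {p q u v} → Digon (Copies _≟_ A) (p , u) (q , v) ≡ true → p ≡ q × Digon A u v ≡ true
  copies-digon {p} {q} {u} {v} e =
    let (p≡q , uv) = copies-arc (∧-conicalˡ _ _ e)
        (_ , vu)   = copies-arc {q} {p} {v} {u} (∧-conicalʳ (Copies _≟_ A (p , u) (q , v)) _ e)
    in p≡q , cong₂ _∧_ uv vu

  copies-digon-same : ∀ p u v → Digon (Copies _≟_ A) (p , u) (p , v) ≡ Digon A u v
  copies-digon-same p u v = cong₂ _∧_ (copies-same p u v) (copies-same p v u)

  copies-pathDecomposition : ∀ {L : Set} →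
    PathDecomposition L (Digon A) → PathDecomposition (P × L) (Digon (Copies _≟_ A))
  copies-pathDecomposition {L} (comp , pos , unique , predecessor , edge⇔) =
    comp′ , pos ∘ proj₂ ,
    (λ (p , u) (q , v) c e → cong₂ _,_ (cong proj₁ c) (unique u v (cong proj₂ c) e)) ,
    (λ (p , v) n e → let (u , c , q) = predecessor v n e in (p , u) , cong (p ,_) c , q) ,
    λ (p , u) (q , v) → mk⇔ (to p q u v) (from p q u v)
    where
    comp′ : P × V → P × L
    comp′ (p , u) = p , comp u
    to : ∀ p q u v → Digon (Copies _≟_ A) (p , u) (q , v) ≡ true →
         comp′ (p , u) ≡ comp′ (q , v) × (pos v ≡ suc (pos u) ⊎ pos u ≡ suc (pos v))
    to p q u v e with copies-digon e
    ... | refl , uv = let (c , adjacent) = Equivalence.to (edge⇔ u v) uv in cong (p ,_) c , adjacent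
    from : ∀ p q u v → comp′ (p , u) ≡ comp′ (q , v) × (pos v ≡ suc (pos u) ⊎ pos u ≡ suc (pos v)) →
           Digon (Copies _≟_ A) (p , u) (q , v) ≡ true
    from p q u v (c , adjacent) with cong proj₁ c
    ... | refl = trans (copies-digon-same p u v) (Equivalence.from (edge⇔ u v) (cong proj₂ c , adjacent))

avoiding : ∀ {k} → Fin (suc (suc k)) → Fin (suc (suc k)) → Fin k → Fin (suc (suc k))
avoiding a b y with a ≟ b
... | yes _   = punchIn a (inject₁ y)
... | no  a≢b = punchIn a (punchIn (punchOut a≢b) y)

avoiding-≢ˡ : ∀ {k} a b (y : Fin k) → avoiding a b y ≢ a
avoiding-≢ˡ a b y with a ≟ b
... | yes _ = punchInᵢ≢i a _
... | no  _ = punchInᵢ≢i a _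

avoiding-≢ʳ : ∀ {k} a b (y : Fin k) → avoiding a b y ≢ b
avoiding-≢ʳ a b y with a ≟ b
... | yes refl = punchInᵢ≢i a _
... | no  a≢b  = λ e → punchInᵢ≢i (punchOut a≢b) y
                   (punchIn-injective a _ _ (trans e (sym (punchIn-punchOut a≢b))))

avoiding-injective : ∀ {k} a b (y z : Fin k) → avoiding a b y ≡ avoiding a b z → y ≡ z
avoiding-injective a b y z e with a ≟ b
... | yes _   = inject₁-injective (punchIn-injective a _ _ e)
... | no  a≢b = punchIn-injective (punchOut a≢b) _ _ (punchIn-injective a _ _ e)

record CertifiedDigraph (k c : ℕ) : Set₁ where
  field
    Vertex              : Set
    size                : ℕ
    enumeration         : Vertex ↔ Fin size
    arc                 : Vertex → Vertex → Bool
    loopless            : ∀ v → arc v v ≡ false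
    eliminationOrdering : EliminationOrdering (Adjacent arc)
    colouring           : ProperColouring (Adjacent arc) k
    clique              : CliqueOf (Adjacent arc) k
    digonPaths          : PathDecomposition Vertex (Digon arc)
    dicolouring         : AcyclicColouring arc c
    dicolouring-minimal : ∀ j → AcyclicColouring arc j → c ≤ j

Realisation : ℕ → ℕ → ℕ → Set
Realisation k c n =
  Σ ℕ λ m → n ≤ m × Σ (Graph m) λ G → Σ (Digraph m) λ D →
    Chordal G × SuperOrientation D G × DisjointUnionOfPaths (BAdj D)
    × CliqueNumber G k × DichromaticNumber D c

realise : ∀ {k c n} (W : CertifiedDigraph k c) → n ≤ CertifiedDigraph.size W → Realisation k c n
realise {k} {c} W n≤size =
  size , n≤size , G , D , chordal , (λ _ _ → refl) , paths , (clique′ , clique-bound) , (dicolouring′ , minimal)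
  where
  open CertifiedDigraph W
  open Inverse enumeration using (to; from; strictlyInverseˡ; strictlyInverseʳ)

  from-injective : ∀ i j → from i ≡ from j → i ≡ j
  from-injective i j e = trans (sym (strictlyInverseˡ i)) (trans (cong to e) (strictlyInverseˡ j))

  to-injective : ∀ u v → to u ≡ to v → u ≡ v
  to-injective u v e = trans (sym (strictlyInverseʳ u)) (trans (cong from e) (strictlyInverseʳ v))

  via-to : (R : Vertex → Vertex → Bool) → ∀ u v → R u v ≡ true → (R on from) (to u) (to v) ≡ true
  via-to R u v = subst₂ (λ x y → R x y ≡ true) (sym (strictlyInverseʳ u)) (sym (strictlyInverseʳ v))

  D : Digraph size
  D = record { arc = arc on from ; loopless = loopless ∘ from }

  G : Graph size
  G = record
    { adj    = Adjacent arc on from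
    ; sym    = λ i j → ∨-comm (arc (from i) (from j)) _
    ; irrefl = λ i → cong₂ _∨_ (loopless (from i)) (loopless (from i))
    }

  chordal : Chordal G
  chordal = eliminationOrdering⇒no-long-induced-cycle (eliminationOrdering-on from from-injective eliminationOrdering)

  paths : DisjointUnionOfPaths (BAdj D)
  paths = pathDecomposition-relabel (toℕ ∘ to) (λ a b → to-injective a b ∘ toℕ-injective)
            (pathDecomposition-on from to strictlyInverseʳ from-injective digonPaths)

  clique′ : HasClique G k
  clique′ = clique-map {F = Adjacent arc on from} to to-injective (via-to (Adjacent arc)) clique

  clique-bound : ∀ j → HasClique G j → j ≤ k
  clique-bound j = colouring-bounds-clique (properColouring-map {F = Adjacent arc on from} from (λ _ _ e → e) colouring)

  dicolouring′ : Dicolourable D c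
  dicolouring′ = acyclicColouring-map {A = arc} {B = arc on from} from from-injective (λ _ _ e → e) dicolouring

  minimal : ∀ j → Dicolourable D j → c ≤ j
  minimal j = dicolouring-minimal j ∘ acyclicColouring-map {A = arc on from} {B = arc} to to-injective (via-to arc)

addIsolated : ∀ {k c} → CertifiedDigraph (suc k) (suc c) → ℕ → CertifiedDigraph (suc k) (suc c)
addIsolated {k} {c} W n = record
  { Vertex              = V′
  ; size                = n + size
  ; enumeration         = ↔-trans (↔-refl ⊎-↔ enumeration) (↔-sym +↔⊎)
  ; arc                 = arc′
  ; loopless            = loopless′
  ; eliminationOrdering = ordering eliminationOrdering
  ; colouring           = colouring′ colouring
  ; clique              = clique-map {F = Adjacent arc′} inj₂ (λ _ _ → inj₂-injective) (λ _ _ e → e) clique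
  ; digonPaths          = pathDecomposition-⊎ (λ _ _ → refl) no-digonʳ digonPaths
  ; dicolouring         = dicolouring′ dicolouring
  ; dicolouring-minimal = λ j → dicolouring-minimal j ∘
                            acyclicColouring-map {A = arc′} {B = arc} inj₂ (λ _ _ → inj₂-injective) (λ _ _ e → e)
  }
  where
  open CertifiedDigraph W
  V′ = Fin n ⊎ Vertex

  arc′ : V′ → V′ → Bool
  arc′ (inj₂ u) (inj₂ v) = arc u v
  arc′ _        _        = false

  loopless′ : ∀ v → arc′ v v ≡ false
  loopless′ (inj₁ _) = refl
  loopless′ (inj₂ u) = loopless u

  no-digonʳ : ∀ w i → Digon arc′ w (inj₁ i) ≡ false
  no-digonʳ (inj₁ _) _ = refl
  no-digonʳ (inj₂ _) _ = refl

  ordering : EliminationOrdering (Adjacent arc) → EliminationOrdering (Adjacent arc′)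
  ordering ord = record { rank = rank′ ; rank-separates = separates ; lower-neighbours-adjacent = lower-adjacent }
    where
    open EliminationOrdering ord
    rank′ : V′ → ℕ
    rank′ (inj₁ _) = 0
    rank′ (inj₂ u) = rank u
    separates : ∀ u v → Adjacent arc′ u v ≡ true → rank′ u ≢ rank′ v
    separates (inj₂ u) (inj₂ v) = rank-separates u v
    separates (inj₁ _) (inj₁ _) ()
    separates (inj₁ _) (inj₂ _) ()
    separates (inj₂ _) (inj₁ _) ()
    lower-adjacent : ∀ v w₁ w₂ → rank′ w₁ < rank′ v → rank′ w₂ < rank′ v →
      Adjacent arc′ v w₁ ≡ true → Adjacent arc′ v w₂ ≡ true → w₁ ≢ w₂ → Adjacent arc′ w₁ w₂ ≡ true
    lower-adjacent (inj₂ v) (inj₂ w₁) (inj₂ w₂) r₁ r₂ e₁ e₂ w₁≢w₂ =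
      lower-neighbours-adjacent v w₁ w₂ r₁ r₂ e₁ e₂ (w₁≢w₂ ∘ cong inj₂)
    lower-adjacent (inj₂ _) (inj₂ _) (inj₁ _) _ _ _ () _
    lower-adjacent (inj₂ _) (inj₁ _) _        _ _ () _ _
    lower-adjacent (inj₁ _) (inj₁ _) _        _ _ () _ _
    lower-adjacent (inj₁ _) (inj₂ _) _        _ _ () _ _

  colouring′ : ProperColouring (Adjacent arc) (suc k) → ProperColouring (Adjacent arc′) (suc k)
  colouring′ (col , proper) = col′ , proper′
    where
    col′ : V′ → Fin (suc k)
    col′ (inj₁ _) = 0F
    col′ (inj₂ u) = col u
    proper′ : ∀ u v → Adjacent arc′ u v ≡ true → col′ u ≢ col′ v
    proper′ (inj₂ u) (inj₂ v) = proper u v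
    proper′ (inj₁ _) (inj₁ _) ()
    proper′ (inj₁ _) (inj₂ _) ()
    proper′ (inj₂ _) (inj₁ _) ()

  dicolouring′ : AcyclicColouring arc (suc c) → AcyclicColouring arc′ (suc c)
  dicolouring′ (col , acyclic) = col′ , λ a →
    acyclic a ∘ cycle-pullback {T = λ v → col′ v ≡ a} inj₂ (λ _ _ → inj₂-injective) (λ _ _ e → e)
                  (λ _ e → e) in-image
    where
    col′ : V′ → Fin (suc c)
    col′ (inj₁ _) = 0F
    col′ (inj₂ u) = col u
    in-image : ∀ {a} w w′ → col′ w ≡ a → arc′ w w′ ≡ true → ∃ λ u → inj₂ u ≡ w
    in-image (inj₂ u) _ _ _ = u , refl

module Blowup {k c : ℕ} (W : CertifiedDigraph k (suc c)) where
  open CertifiedDigraph W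

  N : ℕ
  N = suc (suc c)

  Pair : Set
  Pair = Fin N × Fin N

  _≟ᴾ_ : DecidableEquality Pair
  _≟ᴾ_ = ≡-dec _≟_ _≟_

  open CopiesProperties _≟ᴾ_ {arc}

  V′ : Set
  V′ = Fin N ⊎ (Pair × Vertex)

  -- A transitive tournament on Fin N; copy (a , b) dominates a and is dominated by b unless b = a.
  arc′ : V′ → V′ → Bool
  arc′ (inj₁ x)             (inj₁ y)             = does (toℕ x <? toℕ y)
  arc′ (inj₁ x)             (inj₂ ((a , b) , _)) = does (x ≟ b) ∧ not (does (x ≟ a))
  arc′ (inj₂ ((a , _) , _)) (inj₁ x)             = does (x ≟ a)
  arc′ (inj₂ p)             (inj₂ q)             = Copies _≟ᴾ_ arc p q

  loopless′ : ∀ v → arc′ v v ≡ false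
  loopless′ (inj₁ x)       = dec-false (toℕ x <? toℕ x) (<-irrefl refl)
  loopless′ (inj₂ (p , u)) = trans (copies-same p u u) (loopless u)

  upward : ∀ {x y} → toℕ x < toℕ y → Adjacent arc′ (inj₁ x) (inj₁ y) ≡ true
  upward {x} {y} x<y = arc⇒adjacent arc′ {inj₁ x} {inj₁ y} (dec-true (toℕ x <? toℕ y) x<y)

  tournament-adjacent : ∀ {x y} → x ≢ y → Adjacent arc′ (inj₁ x) (inj₁ y) ≡ true
  tournament-adjacent {x} {y} x≢y with <-cmp (toℕ x) (toℕ y)
  ... | tri< x<y _ _ = upward x<y
  ... | tri≈ _ x≡y _ = contradiction (toℕ-injective x≡y) x≢y
  ... | tri> _ _ y<x = trans (adjacent-sym arc′ {inj₁ x} {inj₁ y}) (upward y<x)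

  attached : ∀ {x a b u} → Adjacent arc′ (inj₁ x) (inj₂ ((a , b) , u)) ≡ true → x ≡ a ⊎ x ≡ b
  attached {x} {a} {b} e with x ≟ a | x ≟ b
  ... | yes x≡a | _       = inj₁ x≡a
  ... | no  _   | yes x≡b = inj₂ x≡b
  ... | no  _   | no  _   = contradiction e λ ()

  attached′ : ∀ {x a b u} → Adjacent arc′ (inj₂ ((a , b) , u)) (inj₁ x) ≡ true → x ≡ a ⊎ x ≡ b
  attached′ {x} {a} {b} {u} e = attached {u = u} (trans (adjacent-sym arc′ {inj₁ x} {inj₂ ((a , b) , u)}) e)

  attach : ∀ {x a b u} → x ≡ a ⊎ x ≡ b → Adjacent arc′ (inj₁ x) (inj₂ ((a , b) , u)) ≡ true
  attach {x} {a} {b} x∈ab with x ≟ a | x ≟ b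
  ... | yes _   | _       = ∨-zeroʳ _
  ... | no  _   | yes _   = refl
  ... | no  x≢a | no  x≢b = contradiction x∈ab [ x≢a , x≢b ]

  attach′ : ∀ {x a b u} → x ≡ a ⊎ x ≡ b → Adjacent arc′ (inj₂ ((a , b) , u)) (inj₁ x) ≡ true
  attach′ {x} {a} {b} {u} x∈ab = trans (adjacent-sym arc′ {inj₂ ((a , b) , u)} {inj₁ x}) (attach {u = u} x∈ab)

  rank′ : V′ → ℕ
  rank′ (inj₁ x)       = toℕ x
  rank′ (inj₂ (_ , u)) = N + EliminationOrdering.rank eliminationOrdering u

  tournament-below : ∀ x r → toℕ x < N + r
  tournament-below x r = ≤-trans (toℕ<n x) (m≤m+n N r)

  ordering : EliminationOrdering (Adjacent arc′)
  ordering = record { rank = rank′ ; rank-separates = separates ; lower-neighbours-adjacent = lower-adjacent }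
    where
    open EliminationOrdering eliminationOrdering
    separates : ∀ u v → Adjacent arc′ u v ≡ true → rank′ u ≢ rank′ v
    separates (inj₁ x)       (inj₁ y)       e = adjacent⇒≢ {A = arc′} loopless′ e ∘ cong inj₁ ∘ toℕ-injective
    separates (inj₁ x)       (inj₂ (_ , v)) _ = <⇒≢ (tournament-below x (rank v))
    separates (inj₂ (_ , u)) (inj₁ y)       _ = <⇒≢ (tournament-below y (rank u)) ∘ sym
    separates (inj₂ (p , u)) (inj₂ (q , v)) e =
      rank-separates u v (proj₂ (copies-adjacent {p} {q} {u} {v} e)) ∘ +-cancelˡ-≡ N _ _
    lower-adjacent : ∀ v w₁ w₂ → rank′ w₁ < rank′ v → rank′ w₂ < rank′ v →
      Adjacent arc′ v w₁ ≡ true → Adjacent arc′ v w₂ ≡ true → w₁ ≢ w₂ → Adjacent arc′ w₁ w₂ ≡ true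
    lower-adjacent _ (inj₁ _) (inj₁ _) _ _ _ _ w₁≢w₂ = tournament-adjacent (w₁≢w₂ ∘ cong inj₁)
    lower-adjacent (inj₁ x) (inj₂ (_ , w)) _ r₁ _ _ _ _ = contradiction r₁ (<-asym (tournament-below x (rank w)))
    lower-adjacent (inj₁ x) (inj₁ _) (inj₂ (_ , w)) _ r₂ _ _ _ =
      contradiction r₂ (<-asym (tournament-below x (rank w)))
    lower-adjacent (inj₂ ((a , b) , u)) (inj₁ y) (inj₂ (q , w)) _ _ e₁ e₂ _
      with proj₁ (copies-adjacent {(a , b)} {q} {u} {w} e₂)
    ... | refl = attach {y} {a} {b} {w} (attached′ {y} {a} {b} {u} e₁)
    lower-adjacent (inj₂ ((a , b) , u)) (inj₂ (q , w)) (inj₁ y) _ _ e₁ e₂ _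
      with proj₁ (copies-adjacent {(a , b)} {q} {u} {w} e₁)
    ... | refl = attach′ {y} {a} {b} {w} (attached′ {y} {a} {b} {u} e₂)
    lower-adjacent (inj₂ (p , u)) (inj₂ (q₁ , w₁)) (inj₂ (q₂ , w₂)) r₁ r₂ e₁ e₂ w₁≢w₂
      with copies-adjacent {p} {q₁} {u} {w₁} e₁ | copies-adjacent {p} {q₂} {u} {w₂} e₂
    ... | refl , a₁ | refl , a₂ = trans (copies-adjacent-same p w₁ w₂)
          (lower-neighbours-adjacent u w₁ w₂ (+-cancelˡ-< N _ _ r₁) (+-cancelˡ-< N _ _ r₂) a₁ a₂
            (w₁≢w₂ ∘ cong (inj₂ ∘ (p ,_))))

  embed : Fin N → Fin (suc (suc k))
  embed x = inject≤ x (s≤s (s≤s (<⇒≤ c<k)))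
    where
    c<k : c < k
    c<k = dicolouring-minimal k (proper⇒acyclic arc colouring)

  colouring′ : ProperColouring (Adjacent arc) k → ProperColouring (Adjacent arc′) (suc (suc k))
  colouring′ (col , proper) = col′ , proper′
    where
    col′ : V′ → Fin (suc (suc k))
    col′ (inj₁ x)             = embed x
    col′ (inj₂ ((a , b) , u)) = avoiding (embed a) (embed b) (col u)
    proper′ : ∀ u v → Adjacent arc′ u v ≡ true → col′ u ≢ col′ v
    proper′ (inj₁ x) (inj₁ y) e = adjacent⇒≢ {A = arc′} loopless′ e ∘ cong inj₁ ∘ inject≤-injective _ _ x y
    proper′ (inj₁ x) (inj₂ ((a , b) , u)) e with attached {x} {a} {b} {u} e
    ... | inj₁ refl = avoiding-≢ˡ (embed x) (embed b) (col u) ∘ sym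
    ... | inj₂ refl = avoiding-≢ʳ (embed a) (embed x) (col u) ∘ sym
    proper′ (inj₂ ((a , b) , u)) (inj₁ x) e with attached′ {x} {a} {b} {u} e
    ... | inj₁ refl = avoiding-≢ˡ (embed x) (embed b) (col u)
    ... | inj₂ refl = avoiding-≢ʳ (embed a) (embed x) (col u)
    proper′ (inj₂ ((a , b) , u)) (inj₂ (q , v)) e with copies-adjacent {(a , b)} {q} {u} {v} e
    ... | refl , uv = proper u v uv ∘ avoiding-injective (embed a) (embed b) (col u) (col v)

  clique′ : CliqueOf (Adjacent arc) k → CliqueOf (Adjacent arc′) (suc (suc k))
  clique′ (f , f-injective , f-adjacent) = f′ , injective , adjacent
    where
    f′ : Fin (suc (suc k)) → V′
    f′ 0F                     = inj₁ 0F
    f′ 1F                     = inj₁ 1F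
    f′ (Fin.suc (Fin.suc i)) = inj₂ ((0F , 1F) , f i)
    injective : ∀ i j → f′ i ≡ f′ j → i ≡ j
    injective 0F                    0F                    _ = refl
    injective 1F                    1F                    _ = refl
    injective (Fin.suc (Fin.suc i)) (Fin.suc (Fin.suc j)) e =
      cong (Fin.suc ∘ Fin.suc) (f-injective i j (cong proj₂ (inj₂-injective e)))
    injective 0F                    1F                    ()
    injective 0F                    (Fin.suc (Fin.suc _)) ()
    injective 1F                    0F                    ()
    injective 1F                    (Fin.suc (Fin.suc _)) ()
    injective (Fin.suc (Fin.suc _)) 0F                    ()
    injective (Fin.suc (Fin.suc _)) 1F                    ()
    adjacent : ∀ i j → i ≢ j → Adjacent arc′ (f′ i) (f′ j) ≡ true
    adjacent 0F                    0F                    i≢j = contradiction refl i≢j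
    adjacent 1F                    1F                    i≢j = contradiction refl i≢j
    adjacent 0F                    1F                    _   = tournament-adjacent {0F} {1F} λ ()
    adjacent 1F                    0F                    _   = tournament-adjacent {1F} {0F} λ ()
    adjacent 0F                    (Fin.suc (Fin.suc j)) _   = attach {0F} {0F} {1F} {f j} (inj₁ refl)
    adjacent 1F                    (Fin.suc (Fin.suc j)) _   = attach {1F} {0F} {1F} {f j} (inj₂ refl)
    adjacent (Fin.suc (Fin.suc i)) 0F                    _   = attach′ {0F} {0F} {1F} {f i} (inj₁ refl)
    adjacent (Fin.suc (Fin.suc i)) 1F                    _   = attach′ {1F} {0F} {1F} {f i} (inj₂ refl)
    adjacent (Fin.suc (Fin.suc i)) (Fin.suc (Fin.suc j)) i≢j =
      trans (copies-adjacent-same (0F , 1F) (f i) (f j)) (f-adjacent i j (i≢j ∘ cong (Fin.suc ∘ Fin.suc)))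

  no-digonˡ : ∀ x w → Digon arc′ (inj₁ x) w ≡ false
  no-digonˡ x (inj₁ y) = ¬-not λ e →
    <-asym (does⇒ (toℕ x <? toℕ y) (∧-conicalˡ _ _ e)) (does⇒ (toℕ y <? toℕ x) (∧-conicalʳ _ _ e))
  no-digonˡ x (inj₂ ((a , b) , _)) with x ≟ a
  ... | yes _ = cong (_∧ true) (∧-zeroʳ (does (x ≟ b)))
  ... | no  _ = ∧-zeroʳ _

  no-digonʳ : ∀ w x → Digon arc′ w (inj₁ x) ≡ false
  no-digonʳ w x = trans (∧-comm (arc′ w (inj₁ x)) _) (no-digonˡ x w)

  paths : PathDecomposition Vertex (Digon arc) → PathDecomposition (Fin N ⊎ (Pair × Vertex)) (Digon arc′)
  paths = pathDecomposition-⊎ no-digonˡ no-digonʳ ∘ copies-pathDecomposition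

  dicolouring′ : AcyclicColouring arc (suc c) → AcyclicColouring arc′ N
  dicolouring′ (col , acyclic) = col′ , acyclic′
    where
    col′ : V′ → Fin N
    col′ (inj₁ _)       = 0F
    col′ (inj₂ (_ , u)) = Fin.suc (col u)
    height : V′ → ℕ
    height (inj₁ x) = toℕ x
    height (inj₂ _) = 0
    increasing : ∀ u v → col′ u ≡ 0F → col′ v ≡ 0F → arc′ u v ≡ true → height u < height v
    increasing (inj₁ x) (inj₁ y) _ _ e = does⇒ (toℕ x <? toℕ y) e
    increasing (inj₁ _) (inj₂ _) _ () _
    increasing (inj₂ _) _        () _ _
    in-copy : ∀ {a} w w′ → col′ w ≡ Fin.suc a → arc′ w w′ ≡ true → ∃ λ x → inj₂ x ≡ w
    in-copy (inj₂ x) _ _ _ = x , refl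
    acyclic′ : ∀ a → ¬ DirectedCycle arc′ (λ v → col′ v ≡ a)
    acyclic′ 0F          = potential⇒no-cycle arc′ _ height increasing
    acyclic′ (Fin.suc a) = acyclic a ∘ copies-cycle {S = λ u → col u ≡ a} ∘
      cycle-pullback {T = λ v → col′ v ≡ Fin.suc a} inj₂ (λ _ _ → inj₂-injective) (λ _ _ e → e)
        (λ _ → suc-injective) in-copy

  minimal : ∀ j → AcyclicColouring arc′ j → N ≤ j
  minimal zero (f , _) with f (inj₁ 0F)
  ... | ()
  minimal (suc j) (f , acyclic) with N ≤? suc j
  ... | yes N≤1+j = N≤1+j
  ... | no  N≰1+j with pigeonhole (≰⇒> N≰1+j) (f ∘ inj₁)
  ...   | a , b , a<b , fa≡fb = s≤s (dicolouring-minimal j (g , acyclic-g))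
    where
    γ : Fin (suc j)
    γ = f (inj₁ a)
    copy : Vertex → V′
    copy u = inj₂ ((a , b) , u)
    a≢b : a ≢ b
    a≢b refl = <-irrefl refl a<b
    b→copy : ∀ u → arc′ (inj₁ b) (copy u) ≡ true
    b→copy u = cong₂ (λ s t → s ∧ not t) (dec-true (b ≟ b) refl) (dec-false (b ≟ a) (a≢b ∘ sym))
    avoids : ∀ u → γ ≢ f (copy u)
    avoids u γ≡fu = acyclic γ (triangle-cycle {A = arc′} {S = λ v → f v ≡ γ} {inj₁ a} {inj₁ b} {copy u}
      (dec-true (toℕ a <? toℕ b) a<b) (b→copy u) (dec-true (a ≟ a) refl)
      (a≢b ∘ inj₁-injective) (λ ()) (λ ()) refl (sym fa≡fb) (sym γ≡fu))
    g : Vertex → Fin j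
    g u = punchOut (avoids u)
    acyclic-g : ∀ e → ¬ DirectedCycle arc (λ v → g v ≡ e)
    acyclic-g e = acyclic (punchIn γ e) ∘
      map-cycle {B = arc′} {T = λ v → f v ≡ punchIn γ e} copy (λ _ _ → cong proj₂ ∘ inj₂-injective)
        (λ u v uv → trans (copies-same (a , b) u v) uv)
        (λ u gu≡e → trans (sym (punchIn-punchOut (avoids u))) (cong (punchIn γ) gu≡e))

  enumeration′ : V′ ↔ Fin (N + N * N * size)
  enumeration′ = ↔-trans (↔-refl ⊎-↔ copies) (↔-sym +↔⊎)
    where
    copies : (Pair × Vertex) ↔ Fin (N * N * size)
    copies = ↔-trans ((↔-sym *↔×) ×-↔ enumeration) (↔-sym *↔×)

blowup : ∀ {k c} → CertifiedDigraph k (suc c) → CertifiedDigraph (suc (suc k)) (suc (suc c))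
blowup W = record
  { Vertex              = V′
  ; size                = N + N * N * size
  ; enumeration         = enumeration′
  ; arc                 = arc′
  ; loopless            = loopless′
  ; eliminationOrdering = ordering
  ; colouring           = colouring′ colouring
  ; clique              = clique′ clique
  ; digonPaths          = paths digonPaths
  ; dicolouring         = dicolouring′ dicolouring
  ; dicolouring-minimal = minimal
  }
  where open CertifiedDigraph W
        open Blowup W

-- A digraph on Fin (suc m) whose digons form a single path, ranked by toℕ and
-- acyclically coloured so that arcs inside a colour class increase toℕ: every
-- such property is decidable, so small examples are certified by computation.
module FinCertificate {m k c : ℕ} (A : Fin (suc m) → Fin (suc m) → Bool) (colour : Fin (suc m) → Fin k)
  (clique : Fin k → Fin (suc m)) (position : Fin (suc m) → ℕ) (dicolour : Fin (suc m) → Fin c) where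

  Consecutive : Fin (suc m) → Fin (suc m) → Set
  Consecutive u v = position v ≡ suc (position u) ⊎ position u ≡ suc (position v)

  consecutive? : ∀ u v → Dec (Consecutive u v)
  consecutive? u v = (position v ℕ.≟ suc (position u)) ⊎-dec (position u ℕ.≟ suc (position v))

  Checks : Set
  Checks =
    (∀ v → A v v ≡ false)
    × (∀ v w₁ w₂ → toℕ w₁ < toℕ v → toℕ w₂ < toℕ v → Adjacent A v w₁ ≡ true → Adjacent A v w₂ ≡ true →
         w₁ ≢ w₂ → Adjacent A w₁ w₂ ≡ true)
    × (∀ u v → Adjacent A u v ≡ true → colour u ≢ colour v)
    × (∀ i j → clique i ≡ clique j → i ≡ j)
    × (∀ i j → i ≢ j → Adjacent A (clique i) (clique j) ≡ true)
    × (∀ u v → position u ≡ position v → u ≡ v)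
    × (∀ v → position v ≢ 0 → ∃ λ u → position u ≡ pred (position v))
    × (∀ u v → Digon A u v ≡ true → Consecutive u v)
    × (∀ u v → Consecutive u v → Digon A u v ≡ true)
    × (∀ u v → dicolour u ≡ dicolour v → A u v ≡ true → toℕ u < toℕ v)

  checks? : Dec Checks
  checks? =
    (all? λ v → A v v Bool.≟ false)
    ×-dec (all? λ v → all? λ w₁ → all? λ w₂ → (toℕ w₁ <? toℕ v) →-dec (toℕ w₂ <? toℕ v) →-dec
             (Adjacent A v w₁ Bool.≟ true) →-dec (Adjacent A v w₂ Bool.≟ true) →-dec
             ¬? (w₁ ≟ w₂) →-dec (Adjacent A w₁ w₂ Bool.≟ true))
    ×-dec (all? λ u → all? λ v → (Adjacent A u v Bool.≟ true) →-dec ¬? (colour u ≟ colour v))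
    ×-dec (all? λ i → all? λ j → (clique i ≟ clique j) →-dec (i ≟ j))
    ×-dec (all? λ i → all? λ j → ¬? (i ≟ j) →-dec (Adjacent A (clique i) (clique j) Bool.≟ true))
    ×-dec (all? λ u → all? λ v → (position u ℕ.≟ position v) →-dec (u ≟ v))
    ×-dec (all? λ v → ¬? (position v ℕ.≟ 0) →-dec any? λ u → position u ℕ.≟ pred (position v))
    ×-dec (all? λ u → all? λ v → (Digon A u v Bool.≟ true) →-dec consecutive? u v)
    ×-dec (all? λ u → all? λ v → consecutive? u v →-dec (Digon A u v Bool.≟ true))
    ×-dec (all? λ u → all? λ v → (dicolour u ≟ dicolour v) →-dec (A u v Bool.≟ true) →-dec
             (toℕ u <? toℕ v))

  certify : Checks → (∀ j → AcyclicColouring A j → c ≤ j) → CertifiedDigraph k c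
  certify (loopless , lower-adjacent , proper , clique-injective , clique-adjacent ,
           position-injective , predecessor , digon⇒consecutive , consecutive⇒digon , increasing) minimal = record
    { Vertex              = Fin (suc m)
    ; size                = suc m
    ; enumeration         = ↔-refl
    ; arc                 = A
    ; loopless            = loopless
    ; eliminationOrdering = record
        { rank                      = toℕ
        ; rank-separates            = λ u v e → adjacent⇒≢ {A = A} loopless e ∘ toℕ-injective
        ; lower-neighbours-adjacent = lower-adjacent
        }
    ; colouring           = colour , proper
    ; clique              = clique , clique-injective , clique-adjacent
    ; digonPaths          = (λ _ → 0F) , position , (λ u v _ → position-injective u v) , predecessor′ ,
                            λ u v → mk⇔ (λ e → refl , digon⇒consecutive u v e) (consecutive⇒digon u v ∘ proj₂)
    ; dicolouring         = dicolour , λ a →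
                              potential⇒no-cycle A _ toℕ λ u v ua va → increasing u v (trans ua (sym va))
    ; dicolouring-minimal = minimal
    }
    where
    predecessor′ : ∀ v p → position v ≡ suc p → ∃ λ u → 0F ≡ 0F × position u ≡ p
    predecessor′ v p e =
      let (u , q) = predecessor v (λ v≡0 → contradiction (trans (sym v≡0) e) λ ())
      in u , refl , trans q (cong pred e)

≢-≢⇒≡ : {x y z : Fin 2} → x ≢ y → y ≢ z → x ≡ z
≢-≢⇒≡ {0F} {0F} {_}  x≢y _   = contradiction refl x≢y
≢-≢⇒≡ {1F} {1F} {_}  x≢y _   = contradiction refl x≢y
≢-≢⇒≡ {_}  {0F} {0F} _   y≢z = contradiction refl y≢z
≢-≢⇒≡ {_}  {1F} {1F} _   y≢z = contradiction refl y≢z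
≢-≢⇒≡ {0F} {1F} {0F} _   _   = refl
≢-≢⇒≡ {1F} {0F} {1F} _   _   = refl

digonArc : Fin 2 → Fin 2 → Bool
digonArc u v = not (does (u ≟ v))

digon-minimal : ∀ j → AcyclicColouring digonArc j → 2 ≤ j
digon-minimal 0 (f , _) with f 0F
... | ()
digon-minimal 1 χ with proj₁ χ 0F | proj₁ χ 1F | digon-colours-differ {A = digonArc} χ {0F} {1F} refl refl (λ ())
... | 0F | 0F | differ = contradiction refl differ
digon-minimal (suc (suc j)) _ = s≤s (s≤s z≤n)

digon : CertifiedDigraph 2 2
digon = certify (from-yes checks?) digon-minimal
  where open FinCertificate digonArc (λ v → v) (λ i → i) toℕ (λ v → v)

-- Digons a b, b c, a z, z x (a, b, c, x, z = 0, 1, 2, 3, 4) and the directed triangle a → c → x → a.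
fanArc : Fin 5 → Fin 5 → Bool
fanArc 0F 1F = true
fanArc 1F 0F = true
fanArc 1F 2F = true
fanArc 2F 1F = true
fanArc 0F 4F = true
fanArc 4F 0F = true
fanArc 3F 4F = true
fanArc 4F 3F = true
fanArc 0F 2F = true
fanArc 2F 3F = true
fanArc 3F 0F = true
fanArc _  _  = false

fanColour : Fin 5 → Fin 3
fanColour 0F = 0F
fanColour 1F = 1F
fanColour 2F = 2F
fanColour 3F = 1F
fanColour 4F = 2F

fanPosition : Fin 5 → ℕ
fanPosition 0F = 2
fanPosition 1F = 3
fanPosition 2F = 4
fanPosition 3F = 0
fanPosition 4F = 1

fanDicolour : Fin 5 → Fin 3
fanDicolour 0F = 0F
fanDicolour 1F = 1F
fanDicolour 2F = 0F
fanDicolour 3F = 2F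
fanDicolour 4F = 1F

-- With two colours the digon paths c b a and a z x force a, c, x to share a colour.
fan-minimal : ∀ j → AcyclicColouring fanArc j → 3 ≤ j
fan-minimal 0 (f , _) with f 0F
... | ()
fan-minimal 1 χ with proj₁ χ 0F | proj₁ χ 1F | digon-colours-differ {A = fanArc} χ {0F} {1F} refl refl (λ ())
... | 0F | 0F | differ = contradiction refl differ
fan-minimal 2 χ@(f , acyclic) = contradiction triangle (acyclic (f 0F))
  where
  differ = digon-colours-differ {A = fanArc} χ
  a≡c : f 0F ≡ f 2F
  a≡c = ≢-≢⇒≡ (differ {0F} {1F} refl refl (λ ())) (differ {1F} {2F} refl refl (λ ()))
  x≡a : f 3F ≡ f 0F
  x≡a = ≢-≢⇒≡ (differ {3F} {4F} refl refl (λ ())) (differ {4F} {0F} refl refl (λ ()))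
  triangle : DirectedCycle fanArc (λ v → f v ≡ f 0F)
  triangle = triangle-cycle {A = fanArc} {S = λ v → f v ≡ f 0F} {0F} {2F} {3F} refl refl refl (λ ()) (λ ()) (λ ()) refl (sym a≡c) x≡a
fan-minimal (suc (suc (suc j))) _ = s≤s (s≤s (s≤s z≤n))

fanClique : Fin 3 → Fin 5
fanClique i = inject≤ i (s≤s (s≤s (s≤s z≤n)))

fan : CertifiedDigraph 3 3
fan = certify (from-yes checks?) fan-minimal
  where open FinCertificate fanArc fanColour fanClique fanPosition fanDicolour

[2+m]/2≡1+m/2 : ∀ m → (2 + m) / 2 ≡ suc (m / 2)
[2+m]/2≡1+m/2 m = m/n≡1+[m∸n]/n {2 + m} {2} (s≤s (s≤s z≤n))

certified : ∀ s → CertifiedDigraph (3 + s) (3 + s / 2)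
certified 0             = fan
certified 1             = blowup digon
certified (suc (suc s)) =
  subst (CertifiedDigraph (5 + s)) (cong (3 +_) (sym ([2+m]/2≡1+m/2 s))) (blowup (certified s))

[3+s+3]/2≡3+s/2 : ∀ s → (3 + s + 3) / 2 ≡ 3 + s / 2
[3+s+3]/2≡3+s/2 s = begin
  (3 + s + 3) / 2  ≡⟨ cong (_/ 2) (+-comm (3 + s) 3) ⟩
  (6 + s) / 2      ≡⟨ [2+m]/2≡1+m/2 (4 + s) ⟩
  1 + (4 + s) / 2  ≡⟨ cong (1 +_) ([2+m]/2≡1+m/2 (2 + s)) ⟩
  2 + (2 + s) / 2  ≡⟨ cong (2 +_) ([2+m]/2≡1+m/2 s) ⟩
  3 + s / 2        ∎

mainTheorem7 : ∀ (k : ℕ) → 3 ≤ k → ∀ (n : ℕ) →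
    Σ ℕ λ m → n ≤ m × Σ (Graph m) λ G → Σ (Digraph m) λ D →
      Chordal G × SuperOrientation D G × DisjointUnionOfPaths (BAdj D)
      × CliqueNumber G k × DichromaticNumber D ((k + 3) / 2)
mainTheorem7 k 3≤k n with m≤n⇒∃[o]m+o≡n 3≤k
... | s , refl = subst (λ c → Realisation (3 + s) c n) (sym ([3+s+3]/2≡3+s/2 s))
                   (realise (addIsolated (certified s) n) (m≤m+n n _))
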